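{- Let $B = \{b_1 < b_2 < \dots\}$ be an infinite sequence of integers with $b_1 \geq 3$. If $b_2 = 3b_1 + 3$ or $b_2 = 3b_1 + 2$, then there is no sequence of positive integers $A = \{a_1 < a_2 < \dots\}$ such that $P(A) = \mathbb{N} \setminus B$.
   Context: $\mathbb{N}$ denotes the set of all nonnegative integers. For a set $A = \{a_1 < a_2 < \dots\}$ of positive integers, $P(A) = \{\sum \varepsilon_i a_i : a_i \in A, \varepsilon_i \in \{0,1\}, \sum \varepsilon_i < \infty\}$ is the set of all finite subset sums of $A$; in particular $0 \in P(A)$ (empty sum). -}

module Defs where

open import Data.Nat using (ℕ; suc; _+_; _*_; _<_; _≤_)
open import Data.Nat.ListAction using (sum)
open import Data.List using (List; map)
open import Data.List.Relation.Unary.Linked using (Linked)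
open import Data.Product using (Σ; _×_; ∃)
open import Relation.Binary.PropositionalEquality using (_≡_)
open import Relation.Nullary using (¬_)
open import Function.Bundles using (_⇔_)

-- An infinite sequence x₀ < x₁ < x₂ < … (paper indices 1,2,… are 0,1,… here).
StrictlyIncreasing : (ℕ → ℕ) → Set
StrictlyIncreasing x = ∀ i → x i < x (suc i)

-- n ∈ P(A): n is a finite subset sum of A = {a 0 < a 1 < …};
-- a finite subset is given by a strictly increasing (hence duplicate-free) list of indices.
InP : (ℕ → ℕ) → ℕ → Set
InP a n = Σ (List ℕ) (λ is → Linked _<_ is × sum (map a is) ≡ n)

InSeq : (ℕ → ℕ) → ℕ → Set
InSeq b n = ∃ (λ k → b k ≡ n)

PEqualsComplement : (ℕ → ℕ) → (ℕ → ℕ) → Set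
PEqualsComplement a b = ∀ n → InP a n ⇔ (¬ InSeq b n)

{-# OPTIONS --safe #-}
-- Let m = b 0 and N = b 1, so m is the only non-sum below N. Since every n < m is a sum, the
-- partial sums of a reach m − 1 exactly, at a prefix a 0, …, a (k − 1) whose subset sums fill
-- [0, m − 1]. As m is not a sum but m + 1 is, a k = m + 1, and the subset sums of a 0, …, a k are
-- [0, 2m] without m. Hence c = a (k + 1) ≤ 2m + 1, and d = a (k + 2) ≤ c + m since c + m would
-- otherwise need the summand m. Now N = d + (N − d) or N = c + (N − c) with the second term in
-- [0, 2m] without m, so N is a sum: a contradiction.
module Submission where

open import Defs
open import Data.Nat using (ℕ; zero; suc; _+_; _*_; _∸_; _≤_; _<_; z≤n; s≤s; z<s; _≟_; _<?_; _≤?_)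
open import Data.Nat.Properties
open import Data.Nat.ListAction using (sum)
open import Data.Nat.Tactic.RingSolver using (solve-∀)
open import Data.List using ([]; _∷_; map)
open import Data.List.Relation.Unary.All as All using (All; []; _∷_)
open import Data.List.Relation.Unary.AllPairs using (AllPairs; []; _∷_)
open import Data.List.Relation.Unary.Linked.Properties using (AllPairs⇒Linked; Linked⇒AllPairs)
open import Data.Sum using (_⊎_; inj₁; inj₂)
open import Data.Product using (Σ; _×_; _,_; uncurry)
open import Relation.Binary.PropositionalEquality
  using (_≡_; _≢_; refl; sym; trans; cong; subst; ≢-sym; module ≡-Reasoning)
open import Relation.Nullary using (¬_; yes; no; contradiction)
open import Function.Bundles using (Equivalence)

module _ {x : ℕ → ℕ} (inc : StrictlyIncreasing x) where

  increasing-< : ∀ {i j} → i < j → x i < x j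
  increasing-< {i} {suc j} i<1+j with m<1+n⇒m<n∨m≡n i<1+j
  ... | inj₁ i<j  = <-trans (increasing-< i<j) (inc j)
  ... | inj₂ refl = inc j

  increasing-≤ : ∀ {i j} → i ≤ j → x i ≤ x j
  increasing-≤ i≤j with m≤n⇒m<n∨m≡n i≤j
  ... | inj₁ i<j  = <⇒≤ (increasing-< i<j)
  ... | inj₂ refl = ≤-refl

  increasing-<⁻¹ : ∀ {i j} → x i < x j → i < j
  increasing-<⁻¹ {i} {j} xi<xj with i <? j
  ... | yes i<j = i<j
  ... | no i≮j  = contradiction (increasing-≤ (≮⇒≥ i≮j)) (<⇒≱ xi<xj)

module SubsetSums (a : ℕ → ℕ) where

  private
    rearrange : ∀ x y z → y + (x + z) ≡ x + y + z
    rearrange = solve-∀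

  data SubsetSum : ℕ → ℕ → Set where
    []   : SubsetSum 0 0
    skip : ∀ {j n} → SubsetSum j n → SubsetSum (suc j) n
    take : ∀ {j n} → SubsetSum j n → SubsetSum (suc j) (a j + n)

  partialSum : ℕ → ℕ
  partialSum zero    = 0
  partialSum (suc j) = a j + partialSum j

  subsetSum≤partialSum : ∀ {j n} → SubsetSum j n → n ≤ partialSum j
  subsetSum≤partialSum []           = z≤n
  subsetSum≤partialSum (skip {j} p) = ≤-trans (subsetSum≤partialSum p) (m≤n+m _ (a j))
  subsetSum≤partialSum (take {j} p) = +-monoʳ-≤ (a j) (subsetSum≤partialSum p)

  subsetSum-weaken : ∀ {i j n} → i ≤ j → SubsetSum i n → SubsetSum j n
  subsetSum-weaken i≤j p with m≤n⇒m<n∨m≡n i≤j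
  ... | inj₂ refl = p
  ... | inj₁ (s≤s i≤j-1) = skip (subsetSum-weaken i≤j-1 p)

  subsetSum-usesLast : ∀ {j n} → SubsetSum (suc j) n → partialSum j < n →
                       Σ ℕ λ r → SubsetSum j r × a j + r ≡ n
  subsetSum-usesLast (skip p) Sj<n = contradiction (subsetSum≤partialSum p) (<⇒≱ Sj<n)
  subsetSum-usesLast (take p) _    = _ , p , refl

  toIndices : ∀ {j n} → SubsetSum j n → ∀ is → AllPairs _<_ is → All (j ≤_) is →
              InP a (n + sum (map a is))
  toIndices []               is sorted _    = is , AllPairs⇒Linked sorted , refl
  toIndices (skip p)         is sorted j<is = toIndices p is sorted (All.map <⇒≤ j<is)
  toIndices (take {j} {n} p) is sorted j<is =
    subst (InP a) (rearrange (a j) n (sum (map a is)))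
      (toIndices p (j ∷ is) (j<is ∷ sorted) (≤-refl ∷ All.map <⇒≤ j<is))

  subsetSum⇒InP : ∀ {j n} → SubsetSum j n → InP a n
  subsetSum⇒InP {n = n} p = subst (InP a) (+-identityʳ n) (toIndices p [] [] [])

  fromIndices : ∀ {i j s} is → AllPairs _<_ is → All (i ≤_) is → All (_< j) is → i ≤ j →
                SubsetSum i s → SubsetSum j (sum (map a is) + s)
  fromIndices []       _             _         _           i≤j p = subsetSum-weaken i≤j p
  fromIndices {s = s} (x ∷ is) (x<is ∷ sorted) (i≤x ∷ _) (x<j ∷ is<j) _ p =
    subst (SubsetSum _) (rearrange (a x) (sum (map a is)) s)
      (fromIndices is sorted x<is is<j x<j (take (subsetSum-weaken i≤x p)))

  Complete : ℕ → Set
  Complete j = ∀ {n} → n ≤ partialSum j → SubsetSum j n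

  complete-zero : Complete 0
  complete-zero z≤n = []

  complete-take : ∀ {j n} → Complete j → a j ≤ n → n ≤ a j + partialSum j → SubsetSum (suc j) n
  complete-take {j} {n} cj aj≤n n≤ =
    subst (SubsetSum (suc j)) (m+[n∸m]≡n aj≤n) (take (cj (m≤n+o⇒m∸n≤o n (a j) n≤)))

  complete-suc : ∀ {j} → Complete j → a j ≤ suc (partialSum j) → Complete (suc j)
  complete-suc {j} cj aj≤ {n} n≤ with n ≤? partialSum j
  ... | yes n≤Sj = skip (cj n≤Sj)
  ... | no  n≰Sj = complete-take cj (≤-trans aj≤ (≰⇒> n≰Sj)) n≤

  complete⇒partialSum<nonSum : ∀ {j m} → Complete j → ¬ InP a m → partialSum j < m
  complete⇒partialSum<nonSum cj m∉ = ≰⇒> λ m≤Sj → m∉ (subsetSum⇒InP (cj m≤Sj))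

  module _ (inc : StrictlyIncreasing a) (positive : 1 ≤ a 0) where

    a-positive : ∀ i → 1 ≤ a i
    a-positive i = ≤-trans positive (increasing-≤ inc z≤n)

    indices< : ∀ {j} is → sum (map a is) < a j → All (_< j) is
    indices< []       _      = []
    indices< (i ∷ is) sum<aj =
      increasing-<⁻¹ inc (≤-<-trans (m≤m+n (a i) _) sum<aj) ∷
      indices< is (≤-<-trans (m≤n+m _ (a i)) sum<aj)

    InP⇒subsetSum : ∀ {j n} → InP a n → n < a j → SubsetSum j n
    InP⇒subsetSum {j} (is , sorted , refl) n<aj =
      subst (SubsetSum j) (+-identityʳ _)
        (fromIndices is (Linked⇒AllPairs <-trans sorted) (All.tabulate λ _ → z≤n)
                     (indices< is n<aj) z≤n [])

    a≤InP-above : ∀ {j n} → InP a n → partialSum j < n → a j ≤ n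
    a≤InP-above n∈P Sj<n = ≮⇒≥ λ n<aj → <⇒≱ Sj<n (subsetSum≤partialSum (InP⇒subsetSum n∈P n<aj))

    j≤partialSum : ∀ j → j ≤ partialSum j
    j≤partialSum zero    = z≤n
    j≤partialSum (suc j) = +-mono-≤ (a-positive j) (j≤partialSum j)

    leastNonSum⇒completePrefix : ∀ {m} → (∀ n → n < m → InP a n) → ¬ InP a m →
                                 Σ ℕ λ k → Complete k × suc (partialSum k) ≡ m
    leastNonSum⇒completePrefix {m} below m∉ with grow m
      where
      grow : ∀ j → (Σ ℕ λ k → Complete k × suc (partialSum k) ≡ m) ⊎ Complete j
      grow zero = inj₂ complete-zero
      grow (suc j) with grow j
      ... | inj₁ found = inj₁ found
      ... | inj₂ cj with suc (partialSum j) ≟ m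
      ...   | yes Sj+1≡m = inj₁ (j , cj , Sj+1≡m)
      ...   | no  Sj+1≢m = inj₂ (complete-suc cj (a≤InP-above (below _ Sj+1<m) ≤-refl))
        where
        Sj+1<m : suc (partialSum j) < m
        Sj+1<m = ≤∧≢⇒< (complete⇒partialSum<nonSum cj m∉) Sj+1≢m
    ... | inj₁ found = found
    ... | inj₂ cm    = contradiction (complete⇒partialSum<nonSum cm m∉) (≤⇒≯ (j≤partialSum m))

    module AfterPrefix {k} (ck : Complete k) where

      m : ℕ
      m = suc (partialSum k)

      module _ {N} (below : ∀ n → n < N → n ≢ m → InP a n) (m∉ : ¬ InP a m)
               (3m+1<N : suc (m + m) + m < N) (N≤3m+3 : N ≤ suc (suc (suc m)) + (m + m)) where

        above : ∀ {n} → m < n → n < N → InP a n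
        above m<n n<N = below _ n<N (>⇒≢ m<n)

        2m+1<N : suc (m + m) < N
        2m+1<N = ≤-<-trans (m≤m+n _ m) 3m+1<N

        a-k≡ : a k ≡ suc m
        a-k≡ = ≤-antisym ak≤m+1 m<ak
          where
          ak≤m+1 : a k ≤ suc m
          ak≤m+1 = a≤InP-above (above (n<1+n m) (≤-<-trans (s≤s (m≤m+n m m)) 2m+1<N))
                               (m<n⇒m<1+n (n<1+n _))
          m<ak : m < a k
          m<ak = ≰⇒> λ ak≤m →
            <⇒≱ (complete⇒partialSum<nonSum (complete-suc ck ak≤m) m∉) (+-monoˡ-≤ _ (a-positive k))

        partialSum-suc-k : partialSum (suc k) ≡ m + m
        partialSum-suc-k = trans (cong (_+ partialSum k) a-k≡) (sym (+-suc m (partialSum k)))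

        sums≤2m : ∀ {n} → n ≤ m + m → n ≢ m → SubsetSum (suc k) n
        sums≤2m {n} n≤2m n≢m with n ≤? partialSum k
        ... | yes n≤s = skip (ck n≤s)
        ... | no  n≰s = complete-take ck (subst (_≤ n) (sym a-k≡) (≤∧≢⇒< (≰⇒> n≰s) (≢-sym n≢m)))
                                         (subst (n ≤_) (sym partialSum-suc-k) n≤2m)

        c d : ℕ
        c = a (suc k)
        d = a (suc (suc k))

        m+1<c : suc m < c
        m+1<c = subst (_< c) a-k≡ (inc k)

        c≤2m+1 : c ≤ suc (m + m)
        c≤2m+1 = a≤InP-above (above (s≤s (m≤m+n m m)) 2m+1<N) (≤-reflexive (cong suc partialSum-suc-k))

        c+m<N : c + m < N
        c+m<N = ≤-<-trans (+-monoˡ-≤ m c≤2m+1) 3m+1<N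

        d≤c+m : d ≤ c + m
        d≤c+m = ≮⇒≥ λ c+m<d → m∉ (subsetSum⇒InP (m∈sums c+m<d))
          where
          m∈sums : c + m < d → SubsetSum (suc k) m
          m∈sums c+m<d with subsetSum-usesLast (InP⇒subsetSum (above m<c+m c+m<N) c+m<d) 2m<c+m
            where
            m<c+m : m < c + m
            m<c+m = <-≤-trans (<-trans (n<1+n m) m+1<c) (m≤m+n c m)
            2m<c+m : partialSum (suc k) < c + m
            2m<c+m = subst (_< c + m) (sym partialSum-suc-k) (+-monoˡ-< m (<-trans (n<1+n m) m+1<c))
          ... | r , r∈sums , c+r≡c+m = subst (SubsetSum (suc k)) (+-cancelˡ-≡ c r m c+r≡c+m) r∈sums

        InP-N : InP a N
        InP-N with d ≟ N ∸ m
        ... | no d≢N∸m =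
          subst (InP a) (m+[n∸m]≡n d≤N) (subsetSum⇒InP (take (skip (sums≤2m N∸d≤2m N∸d≢m))))
          where
          d≤N : d ≤ N
          d≤N = ≤-trans d≤c+m (<⇒≤ c+m<N)
          N∸d≤2m : N ∸ d ≤ m + m
          N∸d≤2m = m≤n+o⇒m∸n≤o N d
                     (≤-trans N≤3m+3 (+-monoˡ-≤ (m + m) (≤-trans (s≤s m+1<c) (inc (suc k)))))
          N∸d≢m : N ∸ d ≢ m
          N∸d≢m N∸d≡m = d≢N∸m (begin
            d               ≡⟨ sym (m+n∸n≡m d m) ⟩
            d + m ∸ m       ≡⟨ cong (λ t → d + t ∸ m) (sym N∸d≡m) ⟩
            d + (N ∸ d) ∸ m ≡⟨ cong (_∸ m) (m+[n∸m]≡n d≤N) ⟩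
            N ∸ m           ∎)
            where open ≡-Reasoning
        ... | yes d≡N∸m =
          subst (InP a) (m+[n∸m]≡n c≤N) (subsetSum⇒InP (take (sums≤2m N∸c≤2m N∸c≢m)))
          where
          c≤N : c ≤ N
          c≤N = ≤-trans (m≤m+n c m) (<⇒≤ c+m<N)
          N≤c+2m : N ≤ c + (m + m)
          N≤c+2m = begin
            N         ≡⟨ sym (m∸n+n≡m (≤-trans (m≤n+m m c) (<⇒≤ c+m<N))) ⟩
            N ∸ m + m ≡⟨ cong (_+ m) (sym d≡N∸m) ⟩
            d + m     ≤⟨ +-monoˡ-≤ m d≤c+m ⟩
            c + m + m ≡⟨ +-assoc c m m ⟩
            c + (m + m) ∎
            where open ≤-Reasoning
          N∸c≤2m : N ∸ c ≤ m + m
          N∸c≤2m = m≤n+o⇒m∸n≤o N c N≤c+2m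
          N∸c≢m : N ∸ c ≢ m
          N∸c≢m N∸c≡m = <-irrefl (trans (cong (c +_) (sym N∸c≡m)) (m+[n∸m]≡n c≤N)) c+m<N

    singleGap⇒InP : ∀ {m N} → ¬ InP a m → (∀ n → n < N → n ≢ m → InP a n) →
                    3 * m + 2 ≤ N → N ≤ 3 * m + 3 → InP a N
    singleGap⇒InP {m} {N} m∉ below lower upper
      with leastNonSum⇒completePrefix (λ n n<m → below n (<-trans n<m m<N) (<⇒≢ n<m)) m∉
      where
      m<N : m < N
      m<N = <-≤-trans (≤-<-trans (m≤n*m m 3) (m<m+n (3 * m) z<s)) lower
    ... | k , ck , refl =
      AfterPrefix.InP-N ck below m∉ (subst (_≤ N) (3m+2≡ m) lower) (subst (N ≤_) (3m+3≡ m) upper)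
      where
      3m+2≡ : ∀ m → 3 * m + 2 ≡ suc (suc (m + m) + m)
      3m+2≡ = solve-∀
      3m+3≡ : ∀ m → 3 * m + 3 ≡ suc (suc (suc m)) + (m + m)
      3m+3≡ = solve-∀

open SubsetSums using (singleGap⇒InP)

≡3m+3⊎≡3m+2⇒bounds : ∀ {m N} → (N ≡ 3 * m + 3) ⊎ (N ≡ 3 * m + 2) →
                     3 * m + 2 ≤ N × N ≤ 3 * m + 3
≡3m+3⊎≡3m+2⇒bounds {m} (inj₁ refl) = +-monoʳ-≤ (3 * m) (n≤1+n 2) , ≤-refl
≡3m+3⊎≡3m+2⇒bounds {m} (inj₂ refl) = ≤-refl , +-monoʳ-≤ (3 * m) (n≤1+n 2)

theorem1p2 : (b : ℕ → ℕ) → StrictlyIncreasing b → 3 ≤ b 0 →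
    (b 1 ≡ 3 * b 0 + 3) ⊎ (b 1 ≡ 3 * b 0 + 2) →
    ¬ (Σ (ℕ → ℕ) λ a → StrictlyIncreasing a × (1 ≤ a 0) × PEqualsComplement a b)
-- The hypothesis 3 ≤ b 0 is not needed: the argument works for every value of b 0.
theorem1p2 b b-inc _ b1≡ (a , a-inc , a-positive , P≡ℕ∖B) =
  b∉P 1 (uncurry (singleGap⇒InP a a-inc a-positive (b∉P 0) belowB1)
                 (≡3m+3⊎≡3m+2⇒bounds {b 0} b1≡))
  where
  b∉P : ∀ i → ¬ InP a (b i)
  b∉P i b-i∈P = Equivalence.to (P≡ℕ∖B (b i)) b-i∈P (i , refl)
  belowB1 : ∀ n → n < b 1 → n ≢ b 0 → InP a n
  belowB1 n n<b1 n≢b0 = Equivalence.from (P≡ℕ∖B n) n∉B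
    where
    n∉B : ¬ InSeq b n
    n∉B (0 , refl)           = n≢b0 refl
    n∉B (1 , refl)           = <-irrefl refl n<b1
    n∉B (suc (suc i) , refl) = <-asym n<b1 (increasing-< b-inc (s≤s z<s))
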